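{- In intensional Martin-Löf type theory (no function extensionality, no truncation assumed), let $X:\mathcal U$ and let $f:X\to X$ with $c:\prod_{x,y:X}f(x)=f(y)$. Then $\mathrm{fix}(f):\equiv\sum_{x:X}x=f(x)$ is a proposition which is logically equivalent to $X$ (there are maps $X\to\mathrm{fix}(f)$ and $\mathrm{fix}(f)\to X$). Consequently $\mathrm{fix}(f)$, together with a map $X\to\mathrm{fix}(f)$, satisfies: it is a proposition, and for every proposition $P:\mathcal U$ and every map $X\to P$ there is a map $\mathrm{fix}(f)\to P$. Moreover, if the theory has weak propositional truncation, then $\lVert X\rVert\simeq\mathrm{fix}(f)$.
   Context: Intensional Martin-Löf type theory with a universe $\mathcal U$, $\Sigma$, $\Pi$, $+$ and identity types (J only; no UIP/K). $\mathrm{isProp}(A):\equiv\prod_{a,b:A}a=b$; "proposition" means a type with $\mathrm{isProp}$. Weak propositional truncation: for every $A:\mathcal U$ a type $\lVert A\rVert:\mathcal U$ with $|{ - }|:A\to\lVert A\rVert$, a proof of $\mathrm{isProp}(\lVert A\rVert)$, and $\mathrm{rec}:\prod_{P:\mathcal U}\mathrm{isProp}(P)\to(A\to P)\to\lVert A\rVert\to P$ (no judgmental computation rule). $A\simeq B$ means there are $g:A\to B$, $h:B\to A$ with $\prod_a h(g(a))=a$ and $\prod_b g(h(b))=b$. -}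

{-# OPTIONS --without-K #-}
module Defs where

open import Level using (Level; suc)
open import Data.Product using (Σ; _×_; _,_)
open import Relation.Binary.PropositionalEquality using (_≡_)

isProp : ∀ {ℓ} → Set ℓ → Set ℓ
isProp A = (a b : A) → a ≡ b

fix : ∀ {ℓ} {X : Set ℓ} → (X → X) → Set ℓ
fix {X = X} f = Σ X (λ x → x ≡ f x)

record _≃_ {ℓ} (A B : Set ℓ) : Set ℓ where
  field
    to      : A → B
    from    : B → A
    from-to : (a : A) → from (to a) ≡ a
    to-from : (b : B) → to (from b) ≡ b

-- Weak propositional truncation for every type in the universe U = Set
-- (no judgmental computation rule).
record WeakTruncation : Set₁ where
  field
    ∥_∥      : Set → Set
    ∣_∣      : {A : Set} → A → ∥ A ∥
    ∥∥-isProp : {A : Set} → isProp ∥ A ∥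
    rec      : {A : Set} (P : Set) → isProp P → (A → P) → ∥ A ∥ → P

{-# OPTIONS --without-K #-}
-- A weakly constant f sends every path a ≡ b to a path f a ≡ f b determined by the
-- constancy witness alone, independently of the path. Hence for two fixed points
-- (x , p) and (y , q), the path e := p ∙ k ∙ q⁻¹ with k : f x ≡ f y canonical makes
-- the square p ∙ cong f e ≡ e ∙ q commute, so fix f is a proposition. A proposition
-- logically equivalent to X then behaves like, and is equivalent to, ∥ X ∥.
module Submission where

open import Defs
open import Data.Product using (Σ; _×_; _,_; proj₁)
open import Function using (_∘_)
open import Relation.Binary.PropositionalEquality
  using (_≡_; refl; sym; trans; cong; module ≡-Reasoning)
open import Relation.Binary.PropositionalEquality.Properties
  using (trans-reflʳ; trans-assoc; trans-symˡ)

cong-wconst : {A B : Set} (f : A → B) (c : (x y : A) → f x ≡ f y)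
  (z : A) {a b : A} (p : a ≡ b) → cong f p ≡ trans (sym (c z a)) (c z b)
cong-wconst f c z {a} refl = sym (trans-symˡ (c z a))

fix-≡ : {X : Set} (f : X → X) {x y : X} {p : x ≡ f x} {q : y ≡ f y}
  (e : x ≡ y) → trans p (cong f e) ≡ trans e q → _≡_ {A = fix f} (x , p) (y , q)
fix-≡ f {p = p} refl square = cong (_ ,_) (trans (sym (trans-reflʳ p)) square)

module _ {X : Set} (f : X → X) (c : (x y : X) → f x ≡ f y) where

  fix-isProp : isProp (fix f)
  fix-isProp (x , p) (y , q) = fix-≡ f e square
    where
    k : f x ≡ f y
    k = trans (sym (c x x)) (c x y)

    e : x ≡ y
    e = trans (trans p k) (sym q)

    square : trans p (cong f e) ≡ trans e q
    square = begin
      trans p (cong f e)                  ≡⟨ cong (trans p) (cong-wconst f c x e) ⟩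
      trans p k                           ≡⟨ sym (trans-reflʳ (trans p k)) ⟩
      trans (trans p k) refl              ≡⟨ cong (trans (trans p k)) (sym (trans-symˡ q)) ⟩
      trans (trans p k) (trans (sym q) q) ≡⟨ sym (trans-assoc (trans p k)) ⟩
      trans e q                           ∎
      where open ≡-Reasoning

  fix-intro : X → fix f
  fix-intro x = f x , c x (f x)

prop-≃ : {A B : Set} → isProp A → isProp B → (A → B) → (B → A) → A ≃ B
prop-≃ A-prop B-prop g h = record
  { to      = g
  ; from    = h
  ; from-to = λ a → A-prop (h (g a)) a
  ; to-from = λ b → B-prop (g (h b)) b
  }

corollary4p4 : (X : Set) (f : X → X) (c : (x y : X) → f x ≡ f y) →
    (isProp (fix f) × (X → fix f) × (fix f → X))
    × (Σ (X → fix f) (λ η →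
        isProp (fix f) × ((P : Set) → isProp P → (X → P) → fix f → P)))
    × ((T : WeakTruncation) → WeakTruncation.∥_∥ T X ≃ fix f)
corollary4p4 X f c =
    (fix-isProp f c , fix-intro f c , proj₁)
  , (fix-intro f c , fix-isProp f c , λ P _ g → g ∘ proj₁)
  , λ T → let open WeakTruncation T in
      prop-≃ ∥∥-isProp (fix-isProp f c)
        (rec (fix f) (fix-isProp f c) (fix-intro f c))
        (∣_∣ ∘ proj₁)
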